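{- There is a constant $C>0$ such that the following holds. Let $\mathcal{G}$ be a 2D SLP deriving a 2D string $T \in \Sigma^{N \times M}$ with $N \le M$, and let $T[i]$ denote the $i$-th row of $T$. Then one can construct a 1D SLP of size at most $C\cdot |\mathcal{G}|\cdot N$ deriving the string $T[1]\cdot T[2]\cdots T[N]$ of length $NM$ (the concatenation of all rows of $T$ in order).
   Context: $\Sigma$ is a fixed finite alphabet. A 2D string of size $N\times M$ is an $N\times M$ array over $\Sigma$. A 2D straight-line program (2D SLP) consists of a finite set of nonterminals, a starting nonterminal, and for each nonterminal $X$ one production whose right-hand side is either a character $\sigma\in\Sigma$, or a horizontal concatenation $\mathrm{hcat}(Y,Z)$ of two nonterminals deriving strings of equal height, or a vertical concatenation $\mathrm{vcat}(Y,Z)$ of two nonterminals deriving strings of equal width, with the relation "$Y$ occurs in the right-hand side of $X$" acyclic; each nonterminal derives a unique 2D string, and the SLP derives the string of its starting nonterminal. A 1D SLP is a 2D SLP using only characters and horizontal concatenations (so it derives a string of height $1$, viewed as an ordinary string). The size of an SLP is the total number of symbols on the right-hand sides of all productions. -}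

module Defs where

open import Data.Nat using (ℕ; zero; suc; _+_)
open import Data.Fin using (Fin; fromℕ; inject₁)
open import Data.List using (List; []; _∷_; length; zipWith; _++_; concat)
open import Relation.Binary.PropositionalEquality using (_≡_)

Alph : ℕ → Set
Alph s = Fin s

-- A 2D string: list of rows (each row a list of characters).
Str2 : ℕ → Set
Str2 s = List (List (Alph s))

height : ∀ {s} → Str2 s → ℕ
height T = length T

width : ∀ {s} → Str2 s → ℕ
width [] = 0
width (r ∷ _) = length r

hjoin : ∀ {s} → Str2 s → Str2 s → Str2 s
hjoin A B = zipWith _++_ A B

vjoin : ∀ {s} → Str2 s → Str2 s → Str2 s
vjoin A B = A ++ B

-- A production whose right-hand side may only mention nonterminals 0..k-1
-- (nonterminals are listed in a topological order, which encodes acyclicity).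
data Rule (s k : ℕ) : Set where
  chr  : Alph s → Rule s k
  hcat : Fin k → Fin k → Rule s k
  vcat : Fin k → Fin k → Rule s k

data Prog (s : ℕ) : ℕ → Set where
  []  : Prog s 0
  _▷_ : ∀ {n} → Prog s n → Rule s n → Prog s (suc n)

record SLP (s : ℕ) : Set where
  constructor slp
  field
    nonterms : ℕ
    prods    : Prog s nonterms
    start    : Fin nonterms
open SLP public

ruleSize : ∀ {s k} → Rule s k → ℕ
ruleSize (chr _)    = 1
ruleSize (hcat _ _) = 2
ruleSize (vcat _ _) = 2

progSize : ∀ {s n} → Prog s n → ℕ
progSize []      = 0
progSize (P ▷ r) = progSize P + ruleSize r

size : ∀ {s} → SLP s → ℕ
size G = progSize (prods G)

data Is1DRule {s k : ℕ} : Rule s k → Set where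
  chr1  : ∀ c → Is1DRule (chr c)
  hcat1 : ∀ y z → Is1DRule (hcat y z)

data Is1DProg {s : ℕ} : ∀ {n} → Prog s n → Set where
  []  : Is1DProg []
  _▷_ : ∀ {n} {P : Prog s n} {r} → Is1DProg P → Is1DRule r → Is1DProg (P ▷ r)

Is1D : ∀ {s} → SLP s → Set
Is1D G = Is1DProg (prods G)

mutual
  data Derives {s : ℕ} : ∀ {n} → Prog s n → Fin n → Str2 s → Set where
    here  : ∀ {n} {P : Prog s n} {r T} → RuleDerives P r T → Derives (P ▷ r) (fromℕ n) T
    there : ∀ {n} {P : Prog s n} {r X T} → Derives P X T → Derives (P ▷ r) (inject₁ X) T

  data RuleDerives {s : ℕ} {n : ℕ} (P : Prog s n) : Rule s n → Str2 s → Set where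
    dchr  : ∀ c → RuleDerives P (chr c) ((c ∷ []) ∷ [])
    dhcat : ∀ {Y Z A B} → Derives P Y A → Derives P Z B → height A ≡ height B →
            RuleDerives P (hcat Y Z) (hjoin A B)
    dvcat : ∀ {Y Z A B} → Derives P Y A → Derives P Z B → width A ≡ width B →
            RuleDerives P (vcat Y Z) (vjoin A B)

SLPDerives : ∀ {s} → SLP s → Str2 s → Set
SLPDerives G T = Derives (prods G) (start G) T

Derives1D : ∀ {s} → SLP s → List (Alph s) → Set
Derives1D G w = SLPDerives G (w ∷ [])

{-# OPTIONS --safe #-}
-- Process the productions of the 2D SLP in order, keeping for every nonterminal X a list of
-- 1D nonterminals deriving the rows of X, one per row. A character costs one new 1D rule,
-- hcat(Y, Z) costs one rule hcat(y_i, z_i) per row, and vcat(Y, Z) costs nothing since the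
-- two lists are just concatenated. With N rows per list, a 2D program with k nonterminals thus
-- becomes a 1D program with at most (N + 1) k nonterminals; chaining the row nonterminals of
-- the start symbol by N - 1 further hcat rules derives T[1] ⋯ T[N], and every rule has size ≤ 2.
module Submission where

open import Defs
open import Data.Nat using (ℕ; zero; suc; _+_; _*_; _≤_; _<_; z≤n; s≤s)
open import Data.Nat.Properties
open import Data.Nat.Tactic.RingSolver using (solve-∀)
open import Data.Fin using (Fin; fromℕ; inject₁)
open import Data.List using (List; []; _∷_; length; zipWith; _++_; concat; take; map)
open import Data.List.Properties using (++-identityʳ; take-all; take-take; length-take)
open import Data.List.Relation.Binary.Pointwise using (Pointwise; []; _∷_; ++⁺; Pointwise-length)
open import Data.Vec as Vec using (Vec; _∷ʳ_)
open import Data.Vec.Properties using (lookup-map)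
open import Data.Product using (Σ; _×_; _,_; ∃₂)
open import Function using (id; _∘_)
open import Relation.Binary.PropositionalEquality

module _ {A : Set} where

  take-idem : ∀ n (xs : List A) → take n (take n xs) ≡ take n xs
  take-idem n xs = trans (take-take n n xs) (cong (λ k → take k xs) (⊓-idem n))

  length-take-≤ : ∀ n (xs : List A) → length (take n xs) ≤ n
  length-take-≤ n xs = ≤-trans (≤-reflexive (length-take n xs)) (m⊓n≤m n (length xs))

  take-++-takeˡ : ∀ n (xs ys : List A) → take n (take n xs ++ ys) ≡ take n (xs ++ ys)
  take-++-takeˡ zero    xs       ys = refl
  take-++-takeˡ (suc n) []       ys = refl
  take-++-takeˡ (suc n) (x ∷ xs) ys = cong (x ∷_) (take-++-takeˡ n xs ys)

  take-++-takeʳ : ∀ {n m} (xs ys : List A) → n ≤ m → take n (xs ++ take m ys) ≡ take n (xs ++ ys)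
  take-++-takeʳ {n} {m} [] ys n≤m =
    trans (take-take n m ys) (cong (λ k → take k ys) (m≤n⇒m⊓n≡m n≤m))
  take-++-takeʳ {zero}  (x ∷ xs) ys _   = refl
  take-++-takeʳ {suc n} (x ∷ xs) ys n<m = cong (x ∷_) (take-++-takeʳ xs ys (<⇒≤ n<m))

  take-++-take : ∀ n (xs ys : List A) → take n (take n xs ++ take n ys) ≡ take n (xs ++ ys)
  take-++-take n xs ys = trans (take-++-takeˡ n xs (take n ys)) (take-++-takeʳ xs ys ≤-refl)

  take-zipWith : ∀ {B C : Set} (f : A → B → C) n xs ys →
                 take n (zipWith f xs ys) ≡ zipWith f (take n xs) (take n ys)
  take-zipWith f zero    xs       ys       = refl
  take-zipWith f (suc n) []       ys       = refl
  take-zipWith f (suc n) (x ∷ xs) []       = refl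
  take-zipWith f (suc n) (x ∷ xs) (y ∷ ys) = cong (f x y ∷_) (take-zipWith f n xs ys)

  lookup-∷ʳ-fromℕ : ∀ {n} (xs : Vec A n) x → Vec.lookup (xs ∷ʳ x) (fromℕ n) ≡ x
  lookup-∷ʳ-fromℕ Vec.[]       x = refl
  lookup-∷ʳ-fromℕ (y Vec.∷ xs) x = lookup-∷ʳ-fromℕ xs x

  lookup-∷ʳ-inject₁ : ∀ {n} (xs : Vec A n) x i → Vec.lookup (xs ∷ʳ x) (inject₁ i) ≡ Vec.lookup xs i
  lookup-∷ʳ-inject₁ (y Vec.∷ xs) x Fin.zero    = refl
  lookup-∷ʳ-inject₁ (y Vec.∷ xs) x (Fin.suc i) = lookup-∷ʳ-inject₁ xs x i

  Pointwise-take : ∀ {B : Set} {R : A → B → Set} n {xs ys} →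
                   Pointwise R xs ys → Pointwise R (take n xs) (take n ys)
  Pointwise-take zero    p       = []
  Pointwise-take (suc n) []      = []
  Pointwise-take (suc n) (r ∷ p) = r ∷ Pointwise-take n p

module _ {s : ℕ} where

  ruleSize-≥1 : ∀ {k} (r : Rule s k) → 1 ≤ ruleSize r
  ruleSize-≥1 (chr _)    = s≤s z≤n
  ruleSize-≥1 (hcat _ _) = s≤s z≤n
  ruleSize-≥1 (vcat _ _) = s≤s z≤n

  ruleSize-≤2 : ∀ {k} (r : Rule s k) → ruleSize r ≤ 2
  ruleSize-≤2 (chr _)    = s≤s z≤n
  ruleSize-≤2 (hcat _ _) = ≤-refl
  ruleSize-≤2 (vcat _ _) = ≤-refl

  nonterminals≤progSize : ∀ {k} (P : Prog s k) → k ≤ progSize P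
  nonterminals≤progSize []      = z≤n
  nonterminals≤progSize (P ▷ r) =
    subst (_≤ progSize P + ruleSize r) (+-comm _ 1)
      (+-mono-≤ (nonterminals≤progSize P) (ruleSize-≥1 r))

  progSize≤2*nonterminals : ∀ {k} (P : Prog s k) → progSize P ≤ 2 * k
  progSize≤2*nonterminals []              = z≤n
  progSize≤2*nonterminals {suc k} (P ▷ r) =
    subst (progSize P + ruleSize r ≤_) (sym (trans (*-suc 2 k) (+-comm 2 (2 * k))))
      (+-mono-≤ (progSize≤2*nonterminals P) (ruleSize-≤2 r))

  mutual
    derives-nonempty : ∀ {k} {P : Prog s k} {X T} → Derives P X T → ∃₂ λ w W → T ≡ w ∷ W
    derives-nonempty (here d)  = ruleDerives-nonempty d
    derives-nonempty (there d) = derives-nonempty d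

    ruleDerives-nonempty : ∀ {k} {P : Prog s k} {r T} → RuleDerives P r T → ∃₂ λ w W → T ≡ w ∷ W
    ruleDerives-nonempty (dchr c) = _ , _ , refl
    ruleDerives-nonempty (dhcat dA dB _) with derives-nonempty dA | derives-nonempty dB
    ... | _ , _ , refl | _ , _ , refl = _ , _ , refl
    ruleDerives-nonempty (dvcat dA dB _) with derives-nonempty dA
    ... | _ , _ , refl = _ , _ , refl

  data _≼_ {m} (Q : Prog s m) : ∀ {m'} → Prog s m' → Set where
    ε   : Q ≼ Q
    _▷_ : ∀ {m'} {Q' : Prog s m'} {r} → Q ≼ Q' → Is1DRule r → Q ≼ (Q' ▷ r)

  rename : ∀ {m m'} {Q : Prog s m} {Q' : Prog s m'} → Q ≼ Q' → Fin m → Fin m'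
  rename ε       = id
  rename (e ▷ _) = inject₁ ∘ rename e

  ≼-derives : ∀ {m m'} {Q : Prog s m} {Q' : Prog s m'} (e : Q ≼ Q') →
              ∀ {X T} → Derives Q X T → Derives Q' (rename e X) T
  ≼-derives ε       = id
  ≼-derives (e ▷ _) = there ∘ ≼-derives e

  ≼-Is1D : ∀ {m m'} {Q : Prog s m} {Q' : Prog s m'} → Q ≼ Q' → Is1DProg Q → Is1DProg Q'
  ≼-Is1D ε       = id
  ≼-Is1D (e ▷ r) = (_▷ r) ∘ ≼-Is1D e

  DerivesRow : ∀ {m} → Prog s m → Fin m → List (Alph s) → Set
  DerivesRow Q X w = Derives Q X (w ∷ [])

  Rows : ∀ {m} → Prog s m → List (Fin m) → Str2 s → Set
  Rows Q = Pointwise (DerivesRow Q)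

  ≼-rows : ∀ {m m'} {Q : Prog s m} {Q' : Prog s m'} (e : Q ≼ Q') →
           ∀ {L T} → Rows Q L T → Rows Q' (map (rename e) L) T
  ≼-rows e []      = []
  ≼-rows e (d ∷ p) = ≼-derives e d ∷ ≼-rows e p

  record Extension {m} (Q : Prog s m) (Out : ℕ → Set) : Set where
    constructor extension
    field
      {m'}  : ℕ
      {prog} : Prog s m'
      grows : Q ≼ prog
      out   : Out m'
  open Extension

  hcatRows : ∀ {m} (Q : Prog s m) → List (Fin m) → List (Fin m) → Extension Q (List ∘ Fin)
  hcatRows Q (y ∷ ys) (z ∷ zs) =
    let extension e L = hcatRows Q ys zs
    in  extension (e ▷ hcat1 (rename e y) (rename e z)) (fromℕ _ ∷ map inject₁ L)
  hcatRows Q _ _ = extension ε []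

  hcatRows-rows : ∀ {m} (Q : Prog s m) ys zs {A B} → Rows Q ys A → Rows Q zs B →
                  Rows (prog (hcatRows Q ys zs)) (out (hcatRows Q ys zs)) (zipWith _++_ A B)
  hcatRows-rows Q []       zs       []      q       = []
  hcatRows-rows Q (y ∷ ys) []       (p ∷ _) []      = []
  hcatRows-rows Q (y ∷ ys) (z ∷ zs) (p ∷ ps) (q ∷ qs) =
    here (dhcat (≼-derives e p) (≼-derives e q) refl)
      ∷ ≼-rows (ε ▷ hcat1 _ _) (hcatRows-rows Q ys zs ps qs)
    where e = grows (hcatRows Q ys zs)

  hcatRows-count : ∀ {m} (Q : Prog s m) ys zs → m' (hcatRows Q ys zs) ≤ length ys + m
  hcatRows-count Q []       zs       = ≤-refl
  hcatRows-count Q (y ∷ ys) []       = m≤n+m _ _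
  hcatRows-count Q (y ∷ ys) (z ∷ zs) = s≤s (hcatRows-count Q ys zs)

  concatRows : ∀ {m} (Q : Prog s m) → Fin m → List (Fin m) → Extension Q Fin
  concatRows Q x []      = extension ε x
  concatRows Q x (y ∷ L) =
    let extension e z = concatRows Q y L
    in  extension (e ▷ hcat1 (rename e x) z) (fromℕ _)

  concatRows-derives : ∀ {m} (Q : Prog s m) {x L w W} → DerivesRow Q x w → Rows Q L W →
                       DerivesRow (prog (concatRows Q x L)) (out (concatRows Q x L)) (concat (w ∷ W))
  concatRows-derives Q {w = w} p [] = subst (DerivesRow Q _) (sym (++-identityʳ w)) p
  concatRows-derives Q {L = y ∷ L} p (q ∷ qs) =
    here (dhcat (≼-derives (grows (concatRows Q y L)) p) (concatRows-derives Q q qs) refl)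

  concatRows-count : ∀ {m} (Q : Prog s m) x L → m' (concatRows Q x L) ≤ length L + m
  concatRows-count Q x []      = ≤-refl
  concatRows-count Q x (y ∷ L) = s≤s (concatRows-count Q y L)

  -- Lists are cut to their first N rows because nonterminals unreachable from the start may be
  -- taller than T; this keeps the cost of every production at most N + 1 new nonterminals.
  module Truncated (N : ℕ) where

    record Simulation {k} (P : Prog s k) : Set where
      field
        {m}     : ℕ
        program : Prog s m
        is1D    : Is1DProg program
        table   : Vec (List (Fin m)) k
        sound   : ∀ {X T} → Derives P X T → Rows program (Vec.lookup table X) (take N T)
        count   : m ≤ k * suc N

    simulateRule : ∀ {m k} (Q : Prog s m) → Vec (List (Fin m)) k → Rule s k → Extension Q (List ∘ Fin)
    simulateRule Q table (chr c)    = extension (ε ▷ chr1 c) (take N (fromℕ _ ∷ []))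
    simulateRule Q table (hcat Y Z) =
      hcatRows Q (take N (Vec.lookup table Y)) (take N (Vec.lookup table Z))
    simulateRule Q table (vcat Y Z) = extension ε (take N (Vec.lookup table Y ++ Vec.lookup table Z))

    simulateRule-sound :
      ∀ {m k} {P : Prog s k} (Q : Prog s m) table r →
      (∀ {X T} → Derives P X T → Rows Q (Vec.lookup table X) (take N T)) →
      ∀ {T} → RuleDerives P r T →
      Rows (prog (simulateRule Q table r)) (out (simulateRule Q table r)) (take N T)
    simulateRule-sound Q table (chr c) sound (dchr .c) = Pointwise-take N (here (dchr c) ∷ [])
    simulateRule-sound {P = P} Q table (hcat Y Z) sound (dhcat {A = A} {B} dA dB _) =
      subst (Rows _ _) (sym (take-zipWith _++_ N A B))
        (hcatRows-rows Q _ _ (truncated dA) (truncated dB))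
      where
      truncated : ∀ {X T} → Derives P X T → Rows Q (take N (Vec.lookup table X)) (take N T)
      truncated {T = T} d = subst (Rows Q _) (take-idem N T) (Pointwise-take N (sound d))
    simulateRule-sound Q table (vcat Y Z) sound (dvcat {A = A} {B} dA dB _) =
      subst (Rows Q _) (take-++-take N A B) (Pointwise-take N (++⁺ (sound dA) (sound dB)))

    simulateRule-count : ∀ {m k} (Q : Prog s m) (table : Vec _ k) r →
                         m' (simulateRule Q table r) ≤ suc N + m
    simulateRule-count Q table (chr c)    = s≤s (m≤n+m _ N)
    simulateRule-count Q table (hcat Y Z) =
      ≤-trans (hcatRows-count Q (take N (Vec.lookup table Y)) _)
              (+-monoˡ-≤ _ (m≤n⇒m≤1+n (length-take-≤ N (Vec.lookup table Y))))
    simulateRule-count Q table (vcat Y Z) = m≤n+m _ _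

    simulate : ∀ {k} (P : Prog s k) → Simulation P
    simulate []      =
      record { program = [] ; is1D = [] ; table = Vec.[] ; sound = λ () ; count = z≤n }
    simulate (P ▷ r) = record
      { program = prog step
      ; is1D    = ≼-Is1D (grows step) is1D
      ; table   = table′
      ; sound   = sound′
      ; count   = ≤-trans (simulateRule-count program table r) (+-monoʳ-≤ (suc N) count)
      }
      where
      open Simulation (simulate P)
      step = simulateRule program table r
      renamed = Vec.map (map (rename (grows step))) table
      table′ = renamed ∷ʳ out step

      sound′ : ∀ {X T} → Derives (P ▷ r) X T → Rows (prog step) (Vec.lookup table′ X) (take N T)
      sound′ (here d) rewrite lookup-∷ʳ-fromℕ renamed (out step) =
        simulateRule-sound program table r sound d
      sound′ (there {X = X} d)
        rewrite lookup-∷ʳ-inject₁ renamed (out step) X | lookup-map X (map (rename (grows step))) table =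
        ≼-rows (grows step) (sound d)

  concatSLP : ∀ {m} {Q : Prog s m} → Is1DProg Q →
              ∀ {L w W n} → Rows Q L (w ∷ W) → 2 * (length W + m) ≤ n →
              Σ (SLP s) λ H → Is1D H × Derives1D H (concat (w ∷ W)) × size H ≤ n
  concatSLP {m} {Q} is1D {W = W} (_∷_ {x = x} {xs = L} p ps) bound =
    slp _ (prog flat) (out flat) , ≼-Is1D (grows flat) is1D , concatRows-derives Q p ps ,
    ≤-trans (progSize≤2*nonterminals (prog flat)) (≤-trans (*-monoʳ-≤ 2 count) bound)
    where
    flat = concatRows Q x L
    count : m' flat ≤ length W + m
    count = subst (λ n → m' flat ≤ n + _) (Pointwise-length ps) (concatRows-count Q x L)

2*[2+k]*[2+N]≤8*[1+k]*[1+N] : ∀ k N → 2 * (suc (suc k) * suc (suc N)) ≤ 8 * suc k * suc N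
2*[2+k]*[2+N]≤8*[1+k]*[1+N] k N =
  subst (2 * (suc (suc k) * suc (suc N)) ≤_) (identity k N) (m≤m+n _ (6 * k * N + 4 * k + 4 * N))
  where
  identity : ∀ k N →
             2 * (suc (suc k) * suc (suc N)) + (6 * k * N + 4 * k + 4 * N) ≡ 8 * suc k * suc N
  identity = solve-∀

flatten : ∀ {s k} (P : Prog s k) {X T} → Derives P X T →
          Σ (SLP s) λ H → Is1D H × Derives1D H (concat T) × size H ≤ 8 * progSize P * height T
flatten {k = zero}  P {()}
flatten {k = suc k} P {X} d with derives-nonempty d
... | w , W , refl = concatSLP is1D rowsOfT size-bound
  where
  N = height (w ∷ W)
  open Truncated N
  open Simulation (simulate P)

  rowsOfT : Rows program (Vec.lookup table X) (w ∷ W)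
  rowsOfT = subst (Rows program _) (take-all N (w ∷ W) ≤-refl) (sound d)

  size-bound : 2 * (length W + m) ≤ 8 * progSize P * N
  size-bound = begin
    2 * (length W + m)         ≤⟨ *-monoʳ-≤ 2 (+-mono-≤ (m≤n+m (length W) 2) count) ⟩
    2 * (suc (suc k) * suc N)  ≤⟨ 2*[2+k]*[2+N]≤8*[1+k]*[1+N] k (length W) ⟩
    8 * suc k * N              ≤⟨ *-monoˡ-≤ N (*-monoʳ-≤ 8 (nonterminals≤progSize P)) ⟩
    8 * progSize P * N         ∎
    where open ≤-Reasoning

lemma3p3 : (s : ℕ) → Σ ℕ λ C → 0 < C ×
    ((G : SLP s) (T : Str2 s) → SLPDerives G T → height T ≤ width T →
    Σ (SLP s) λ H → Is1D H × Derives1D H (concat T) × size H ≤ C * size G * height T)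
lemma3p3 s = 8 , s≤s z≤n , λ G T derives _ → flatten (prods G) derives
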